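{- For an integer $l\geq 3$ let $B_l=(1,2,3,\ldots,l-1,2l-2,2l-1,4l-4)$, so that, writing $B_l=(b_0,b_1,\ldots,b_{l+1})$, we have $b_i=i+1$ for $0\leq i\leq l-2$, $b_{l-1}=2l-2$, $b_l=2l-1$, $b_{l+1}=4l-4$. Then every prefix currency $(b_0,\ldots,b_j)$ with $0\leq j\leq l+1$, $j\neq l$, is orderly (in particular $B_l$ itself is orderly), while the prefix $(b_0,\ldots,b_l)=(1,2,\ldots,l-1,2l-2,2l-1)$ is not orderly.
   Context: A currency is a finite sequence of integers $A=(a_0,a_1,\ldots,a_k)$ with $1=a_0<a_1<\cdots<a_k$. For an integer amount $c>0$, $\mathrm{opt}_A(c)$ is the minimum number of coins (values from $A$, repetitions allowed) summing to $c$, and $\mathrm{grd}_A(c)$ is the number of coins used by the greedy algorithm, which repeatedly takes the largest coin not exceeding the remaining amount. $A$ is orderly if $\mathrm{opt}_A(c)=\mathrm{grd}_A(c)$ for all integers $c>0$. -}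

module Defs where

open import Data.Nat using (ℕ; zero; suc; _+_; _*_; _∸_; _≤_; _<_; _≤ᵇ_)
open import Data.Bool using (if_then_else_)
open import Data.List using (List; []; _∷_; _++_; length; take; upTo; map)
open import Data.Nat.ListAction using (sum)
open import Data.List.Relation.Unary.All using (All)
open import Data.List.Membership.Propositional using (_∈_)
open import Data.Product using (Σ; _×_; _,_)
open import Data.Maybe using (Maybe; just; nothing)
open import Relation.Binary.PropositionalEquality using (_≡_)

-- A currency is given as a list of coin values (a₀, …, a_k), increasing, with a₀ = 1.

Rep : List ℕ → ℕ → List ℕ → Set
Rep A c cs = All (_∈ A) cs × sum cs ≡ c

IsOpt : List ℕ → ℕ → ℕ → Set
IsOpt A c m =
  Σ (List ℕ) (λ cs → Rep A c cs × length cs ≡ m)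
  × (∀ cs → Rep A c cs → m ≤ length cs)

largestCoin : List ℕ → ℕ → Maybe ℕ
largestCoin [] r = nothing
largestCoin (a ∷ as) r with largestCoin as r
... | just b = just b
... | nothing = if a ≤ᵇ r then just a else nothing

-- Greedy, with fuel: repeatedly take the largest coin not exceeding the remainder.
-- Fuel c suffices whenever 1 ∈ A (each step removes at least 1).
grdFuel : ℕ → List ℕ → ℕ → ℕ
grdFuel zero A r = zero
grdFuel (suc f) A zero = zero
grdFuel (suc f) A (suc r) with largestCoin A (suc r)
... | just b = suc (grdFuel f A (suc r ∸ b))
... | nothing = zero

grd : List ℕ → ℕ → ℕ
grd A c = grdFuel c A c

Orderly : List ℕ → Set
Orderly A = ∀ c → 0 < c → IsOpt A c (grd A c)

B : ℕ → List ℕ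
B l = map suc (upTo (l ∸ 1)) ++ (2 * l ∸ 2) ∷ (2 * l ∸ 1) ∷ (4 * l ∸ 4) ∷ []

module Submission where

-- The theorem concerns, for m = l - 1 ≥ 2, the currencies
--   oneTo m = (1, …, m),  C₁ = oneTo m ++ [2m],  C₂ = C₁ ++ [2m+1],  C₃ = C₂ ++ [4m],
-- which (together with the prefixes oneTo n, n ≤ m) are exactly the prefixes of B_l.
--
-- Orderliness is proved by one general criterion (orderly-by-invariant): if a relation
-- N x k ("x has a k-coin representation in some normal form") holds for (0,0), is preserved
-- by adding any coin, and greedy pays any x with N x k using at most k coins, then greedy is
-- optimal.  The normal forms are
--   oneTo n : x ≤ k·n;   C₁ : some 2m's plus small coins;
--   C₃      : some 4m's, at most one of 2m, 2m+1, plus small coins,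
-- the last being preserved thanks to the exchanges 2m+2m = 4m, 2m+(2m+1) = 4m+1,
-- (2m+1)+(2m+1) = 4m+2.  Amounts made of s small coins are handled uniformly by
-- greedy-within: if every greedy step uses a coin ≥ m (or finishes), then c ≤ s·m
-- implies grd c ≤ s.  Finally C₂ is not orderly: greedy pays 4m as (2m+1) + m + (m-1),
-- while 2m + 2m uses two coins.

open import Defs
open import Data.Nat using (ℕ; _≤_; _+_)
open import Data.List using (take)
open import Data.Product using (_×_)
open import Relation.Nullary using (¬_)
open import Relation.Binary.PropositionalEquality using (_≢_)

open import Data.Nat
  using (zero; suc; _*_; _∸_; _<_; _≤ᵇ_; z≤n; s≤s; s≤s⁻¹; compare; less; equal; greater)
open import Data.Nat.Properties
open import Data.Nat.Tactic.RingSolver using (solve-∀)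
open import Data.Nat.ListAction using (sum)
open import Data.Bool using (true; false; if_then_else_)
open import Data.Empty using (⊥-elim)
open import Data.List using (List; []; _∷_; _++_; length; map; upTo; applyUpTo)
open import Data.List.Properties using (map-++; upTo-∷ʳ; length-map; length-upTo; take-map; ++-assoc)
open import Data.List.Relation.Unary.All using (All; []; _∷_)
open import Data.List.Relation.Unary.Any using (here; there)
open import Data.List.Membership.Propositional using (_∈_)
open import Data.List.Membership.Propositional.Properties
  using (∈-++⁻; ∈-++⁺ˡ; ∈-++⁺ʳ; ∈-map⁺; ∈-map⁻; ∈-upTo⁺; ∈-upTo⁻)
open import Data.Maybe using (Maybe; just; nothing; _<∣>_)
open import Data.Maybe.Properties using (<∣>-assoc; <∣>-identityʳ)
open import Data.Product using (∃; _,_; proj₁; proj₂)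
import Data.Product as Product
open import Data.Sum using (_⊎_; inj₁; inj₂)
import Data.Sum as Sum
open import Function using (_∘_)
open import Relation.Nullary using (yes; no; contradiction)
open import Relation.Nullary.Reflects using (ofʸ; ofⁿ)
open import Relation.Binary.PropositionalEquality using (_≡_; refl; sym; trans; cong; cong₂; subst; module ≡-Reasoning)
open import Algebra.Properties.CommutativeSemigroup +-commutativeSemigroup
  renaming (x∙yz≈y∙xz to +-exchange)

fits : ℕ → ℕ → Maybe ℕ
fits a r = if a ≤ᵇ r then just a else nothing

fits-yes : ∀ {a r} → a ≤ r → fits a r ≡ just a
fits-yes {a} {r} a≤r with a ≤ᵇ r | ≤ᵇ-reflects-≤ a r
... | true  | _       = refl
... | false | ofⁿ a≰r = contradiction a≤r a≰r

fits-no : ∀ {a r} → r < a → fits a r ≡ nothing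
fits-no {a} {r} r<a with a ≤ᵇ r | ≤ᵇ-reflects-≤ a r
... | true  | ofʸ a≤r = contradiction a≤r (<⇒≱ r<a)
... | false | _       = refl

fits-sound : ∀ {a r b} → fits a r ≡ just b → a ≡ b × a ≤ r
fits-sound {a} {r} eq with a ≤ᵇ r | ≤ᵇ-reflects-≤ a r
fits-sound refl | true | ofʸ a≤r = refl , a≤r

largestCoin-∷ : ∀ a as r → largestCoin (a ∷ as) r ≡ largestCoin as r <∣> fits a r
largestCoin-∷ a as r with largestCoin as r
... | just _  = refl
... | nothing = refl

largestCoin-++ : ∀ xs ys r → largestCoin (xs ++ ys) r ≡ largestCoin ys r <∣> largestCoin xs r
largestCoin-++ [] ys r = sym (<∣>-identityʳ _)
largestCoin-++ (x ∷ xs) ys r = begin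
  largestCoin (x ∷ xs ++ ys) r                              ≡⟨ largestCoin-∷ x (xs ++ ys) r ⟩
  largestCoin (xs ++ ys) r <∣> fits x r                     ≡⟨ cong (_<∣> fits x r) (largestCoin-++ xs ys r) ⟩
  (largestCoin ys r <∣> largestCoin xs r) <∣> fits x r      ≡⟨ <∣>-assoc (largestCoin ys r) _ _ ⟩
  largestCoin ys r <∣> (largestCoin xs r <∣> fits x r)      ≡⟨ cong (largestCoin ys r <∣>_) (sym (largestCoin-∷ x xs r)) ⟩
  largestCoin ys r <∣> largestCoin (x ∷ xs) r               ∎
  where open ≡-Reasoning

largestCoin-snoc-fits : ∀ xs {a r} → a ≤ r → largestCoin (xs ++ a ∷ []) r ≡ just a
largestCoin-snoc-fits xs {a} {r} a≤r =
  trans (largestCoin-++ xs (a ∷ []) r) (cong (_<∣> largestCoin xs r) (fits-yes a≤r))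

largestCoin-snoc-skip : ∀ xs {a r} → r < a → largestCoin (xs ++ a ∷ []) r ≡ largestCoin xs r
largestCoin-snoc-skip xs {a} {r} r<a =
  trans (largestCoin-++ xs (a ∷ []) r) (cong (_<∣> largestCoin xs r) (fits-no r<a))

<∣>-just : ∀ (x y : Maybe ℕ) {b} → x <∣> y ≡ just b → x ≡ just b ⊎ y ≡ just b
<∣>-just (just _) _ eq = inj₁ eq
<∣>-just nothing  _ eq = inj₂ eq

largestCoin-sound : ∀ A {r b} → largestCoin A r ≡ just b → b ∈ A × b ≤ r
largestCoin-sound (a ∷ as) {r} eq
  with <∣>-just (largestCoin as r) (fits a r) (trans (sym (largestCoin-∷ a as r)) eq)
... | inj₁ e = Product.map₁ there (largestCoin-sound as e)
... | inj₂ e with refl , a≤r ← fits-sound e = here refl , a≤r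

largestCoin-complete : ∀ {A a r} → a ∈ A → a ≤ r → largestCoin A r ≢ nothing
largestCoin-complete {x ∷ xs} {r = r} a∈ a≤r with largestCoin xs r in e
... | just _  = λ ()
... | nothing with a∈
...   | here refl = λ eq → contradiction (trans (sym (fits-yes a≤r)) eq) λ ()
...   | there a∈xs = ⊥-elim (largestCoin-complete a∈xs a≤r e)

-- All coins are positive, so every greedy step makes progress.
Positive : List ℕ → Set
Positive A = ∀ {a} → a ∈ A → 0 < a

∈-snoc⁻ : ∀ {xs : List ℕ} {a x} → x ∈ xs ++ a ∷ [] → x ∈ xs ⊎ x ≡ a
∈-snoc⁻ {xs} x∈ = Sum.map₂ (λ { (here eq) → eq }) (∈-++⁻ xs x∈)

positive-snoc : ∀ {xs a} → Positive xs → 0 < a → Positive (xs ++ a ∷ [])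
positive-snoc pos 0<a x∈ with ∈-snoc⁻ x∈
... | inj₁ x∈xs = pos x∈xs
... | inj₂ refl = 0<a

step-decreases : ∀ {b} r → 0 < b → suc r ∸ b ≤ r
step-decreases {suc b} r _ = m∸n≤m r b

grdFuel-stable : ∀ {A} → Positive A → ∀ f f′ r → r ≤ f → r ≤ f′ → grdFuel f A r ≡ grdFuel f′ A r
grdFuel-stable pos zero    zero     _       _ _ = refl
grdFuel-stable pos zero    (suc f′) zero    _ _ = refl
grdFuel-stable pos (suc f) zero     zero    _ _ = refl
grdFuel-stable pos (suc f) (suc f′) zero    _ _ = refl
grdFuel-stable {A} pos (suc f) (suc f′) (suc r) (s≤s r≤f) (s≤s r≤f′) with largestCoin A (suc r) in e
... | nothing = refl
... | just b  = cong suc (grdFuel-stable pos f f′ (suc r ∸ b) (≤-trans dec r≤f) (≤-trans dec r≤f′))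
  where dec = step-decreases r (pos (proj₁ (largestCoin-sound A e)))

grd-step : ∀ {A c b} → Positive A → largestCoin A c ≡ just b → grd A c ≡ suc (grd A (c ∸ b))
grd-step {A} {zero} pos e =
  let b∈ , b≤0 = largestCoin-sound A e in contradiction b≤0 (<⇒≱ (pos b∈))
grd-step {A} {suc r} {b} pos e rewrite e =
  cong suc (grdFuel-stable pos r (suc r ∸ b) (suc r ∸ b)
    (step-decreases r (pos (proj₁ (largestCoin-sound A e)))) ≤-refl)

grd-step+ : ∀ {A b x} → Positive A → largestCoin A (b + x) ≡ just b → grd A (b + x) ≡ suc (grd A x)
grd-step+ {A} {b} {x} pos e = trans (grd-step pos e) (cong (suc ∘ grd A) (m+n∸m≡n b x))

grd-top : ∀ {xs a x} → Positive (xs ++ a ∷ []) → grd (xs ++ a ∷ []) (a + x) ≡ suc (grd (xs ++ a ∷ []) x)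
grd-top {xs} {a} {x} pos = grd-step+ pos (largestCoin-snoc-fits xs (m≤m+n a x))

greedy-rep : ∀ {A} → 1 ∈ A → Positive A → ∀ f r → r ≤ f →
             ∃ λ cs → Rep A r cs × length cs ≡ grdFuel f A r
greedy-rep one pos zero    zero _ = [] , ([] , refl) , refl
greedy-rep one pos (suc f) zero _ = [] , ([] , refl) , refl
greedy-rep {A} one pos (suc f) (suc r) (s≤s r≤f) with largestCoin A (suc r) in e
... | nothing = ⊥-elim (largestCoin-complete one (s≤s z≤n) e)
... | just b
  with b∈ , b≤ ← largestCoin-sound A e
  with cs , (cs∈ , Σcs) , len ← greedy-rep one pos f (suc r ∸ b) (≤-trans (step-decreases r (pos b∈)) r≤f)
  = b ∷ cs , (b∈ ∷ cs∈ , trans (cong (b +_) Σcs) (m+[n∸m]≡n b≤)) , cong suc len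

-- Orderliness from an invariant N x k: "x has a k-coin representation in normal form".
orderly-by-invariant : ∀ {A} → 1 ∈ A → Positive A → (N : ℕ → ℕ → Set) → N 0 0 →
  (∀ {a x k} → a ∈ A → N x k → N (a + x) (suc k)) →
  (∀ {x k} → N x k → grd A x ≤ k) → Orderly A
orderly-by-invariant {A} one pos N start add bound c _ =
  greedy-rep one pos c c ≤-refl , λ { cs (cs∈ , refl) → bound (reach cs∈) }
  where
  reach : ∀ {cs} → All (_∈ A) cs → N (sum cs) (length cs)
  reach []           = start
  reach (a∈ ∷ rest) = add a∈ (reach rest)

StepsAtLeast : List ℕ → ℕ → Set
StepsAtLeast A m = ∀ r → 0 < r → ∃ λ b → largestCoin A r ≡ just b × (m ≤ b ⊎ b ≡ r)

steps-snoc : ∀ {A m a} → StepsAtLeast A m → m ≤ a → StepsAtLeast (A ++ a ∷ []) m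
steps-snoc {A} {a = a} steps m≤a r 0<r with a ≤? r
... | yes a≤r = a , largestCoin-snoc-fits A a≤r , inj₁ m≤a
... | no a≰r with b , e , big ← steps r 0<r = b , trans (largestCoin-snoc-skip A (≰⇒> a≰r)) e , big

greedy-within : ∀ {A m} → Positive A → StepsAtLeast A m → ∀ s c → c ≤ s * m → grd A c ≤ s
greedy-within pos steps s       zero    _ = z≤n
greedy-within {A} {m} pos steps (suc s) (suc c) c≤ with steps (suc c) (s≤s z≤n)
... | b , e , inj₁ m≤b = begin
  grd A (suc c)             ≡⟨ grd-step pos e ⟩
  suc (grd A (suc c ∸ b))   ≤⟨ s≤s (greedy-within pos steps s (suc c ∸ b) rest) ⟩
  suc s                     ∎
  where
  open ≤-Reasoning
  rest : suc c ∸ b ≤ s * m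
  rest = ≤-trans (∸-monoʳ-≤ (suc c) m≤b) (m≤n+o⇒m∸n≤o (suc c) m c≤)
... | b , e , inj₂ refl = begin
  grd A (suc c)             ≡⟨ grd-step pos e ⟩
  suc (grd A (suc c ∸ suc c)) ≡⟨ cong (suc ∘ grd A) (n∸n≡0 (suc c)) ⟩
  1                         ≤⟨ s≤s z≤n ⟩
  suc s                     ∎
  where open ≤-Reasoning

oneTo : ℕ → List ℕ
oneTo n = map suc (upTo n)

-- (1, …, n+1) = (1, …, n) ++ [n+1]: every currency here is built by appending coins.
oneTo-snoc : ∀ n → oneTo (suc n) ≡ oneTo n ++ suc n ∷ []
oneTo-snoc n = trans (cong (map suc) (sym (upTo-∷ʳ n))) (map-++ suc (upTo n) (n ∷ []))

∈-oneTo⁻ : ∀ {n a} → a ∈ oneTo n → 0 < a × a ≤ n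
∈-oneTo⁻ a∈ with i , i∈ , refl ← ∈-map⁻ suc a∈ = s≤s z≤n , ∈-upTo⁻ i∈

1∈oneTo : ∀ {n} → 0 < n → 1 ∈ oneTo n
1∈oneTo 0<n = ∈-map⁺ suc (∈-upTo⁺ 0<n)

positive-oneTo : ∀ {n} → Positive (oneTo n)
positive-oneTo = proj₁ ∘ ∈-oneTo⁻

largestCoin-oneTo-top : ∀ {n r} → 0 < n → n ≤ r → largestCoin (oneTo n) r ≡ just n
largestCoin-oneTo-top {suc n} {r} _ n≤r =
  trans (cong (λ A → largestCoin A r) (oneTo-snoc n)) (largestCoin-snoc-fits (oneTo n) n≤r)

largestCoin-oneTo-exact : ∀ {n r} → 0 < r → r ≤ n → largestCoin (oneTo n) r ≡ just r
largestCoin-oneTo-exact {zero} 0<r r≤0 = contradiction r≤0 (<⇒≱ 0<r)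
largestCoin-oneTo-exact {suc n} {r} 0<r r≤ with m≤n⇒m<n∨m≡n r≤
... | inj₂ refl = largestCoin-oneTo-top 0<r ≤-refl
... | inj₁ r<   = begin
  largestCoin (oneTo (suc n)) r          ≡⟨ cong (λ A → largestCoin A r) (oneTo-snoc n) ⟩
  largestCoin (oneTo n ++ suc n ∷ []) r  ≡⟨ largestCoin-snoc-skip (oneTo n) r< ⟩
  largestCoin (oneTo n) r                ≡⟨ largestCoin-oneTo-exact 0<r (s≤s⁻¹ r<) ⟩
  just r                                 ∎
  where open ≡-Reasoning

steps-oneTo : ∀ {n} → 0 < n → StepsAtLeast (oneTo n) n
steps-oneTo {n} 0<n r 0<r with n ≤? r
... | yes n≤r = n , largestCoin-oneTo-top 0<n n≤r , inj₁ ≤-refl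
... | no n≰r  = r , largestCoin-oneTo-exact 0<r (<⇒≤ (≰⇒> n≰r)) , inj₂ refl

oneTo-orderly : ∀ {n} → 0 < n → Orderly (oneTo n)
oneTo-orderly {n} 0<n =
  orderly-by-invariant (1∈oneTo 0<n) positive-oneTo (λ x k → x ≤ k * n) z≤n
    (λ a∈ x≤ → +-mono-≤ (proj₂ (∈-oneTo⁻ a∈)) x≤)
    (λ {x} {k} → greedy-within positive-oneTo (steps-oneTo 0<n) k x)

module Family (m : ℕ) where

  D D₁ Q : ℕ
  D  = m + m
  D₁ = suc D
  Q  = D + D

  C₁ C₂ C₃ : List ℕ
  C₁ = oneTo m ++ D ∷ []
  C₂ = C₁ ++ D₁ ∷ []
  C₃ = C₂ ++ Q ∷ []

  tail : List ℕ
  tail = D ∷ D₁ ∷ Q ∷ []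

  data Normal₁ : ℕ → ℕ → Set where
    small : ∀ {σ s} → σ ≤ s * m → Normal₁ σ s
    plusD : ∀ {x k} → Normal₁ x k → Normal₁ (D + x) (suc k)

  data Normal₃ : ℕ → ℕ → Set where
    small  : ∀ {σ s} → σ ≤ s * m → Normal₃ σ s
    withD  : ∀ {σ s} → σ ≤ s * m → Normal₃ (D + σ) (suc s)
    withD₁ : ∀ {σ s} → σ ≤ s * m → Normal₃ (D₁ + σ) (suc s)
    plusQ  : ∀ {x k} → Normal₃ x k → Normal₃ (Q + x) (suc k)

  recast₁ : ∀ {y z k} → y ≡ z → Normal₁ y k → Normal₁ z k
  recast₁ {k = k} = subst (λ w → Normal₁ w k)

  recast₃ : ∀ {y z k} → y ≡ z → Normal₃ y k → Normal₃ z k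
  recast₃ {k = k} = subst (λ w → Normal₃ w k)

  data Coin₃ : ℕ → Set where
    smallCoin : ∀ {a} → a ≤ m → Coin₃ a
    coinD     : Coin₃ D
    coinD₁    : Coin₃ D₁
    coinQ     : Coin₃ Q

module _ {m : ℕ} (0<m : 0 < m) where
  open Family m

  0<D : 0 < D
  0<D = ≤-trans 0<m (m≤m+n m m)

  positive-C₁ : Positive C₁
  positive-C₁ = positive-snoc positive-oneTo 0<D

  positive-C₂ : Positive C₂
  positive-C₂ = positive-snoc positive-C₁ (s≤s z≤n)

  steps-C₁ : StepsAtLeast C₁ m
  steps-C₁ = steps-snoc {oneTo m} (steps-oneTo 0<m) (m≤m+n m m)

  -- Adding a coin to a normal form for C₁ gives a normal form with one more coin;
  -- a small coin is moved past the coins 2m.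
  absorb₁ : ∀ {a x k} → a ∈ C₁ → Normal₁ x k → Normal₁ (a + x) (suc k)
  absorb₁ a∈ n with ∈-snoc⁻ a∈
  ... | inj₂ refl  = plusD n
  ... | inj₁ a∈oneTo = absorbSmall (proj₂ (∈-oneTo⁻ a∈oneTo)) n
    where
    absorbSmall : ∀ {a x k} → a ≤ m → Normal₁ x k → Normal₁ (a + x) (suc k)
    absorbSmall a≤m (small σ≤) = small (+-mono-≤ a≤m σ≤)
    absorbSmall {a} a≤m (plusD {x} n) =
      recast₁ (sym (+-exchange a D x)) (plusD (absorbSmall a≤m n))

  -- Greedy takes the coins 2m first and then pays the small part within s coins.
  bound₁ : ∀ {x k} → Normal₁ x k → grd C₁ x ≤ k
  bound₁ (small σ≤) = greedy-within positive-C₁ steps-C₁ _ _ σ≤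
  bound₁ (plusD n)  = ≤-trans (≤-reflexive (grd-top positive-C₁)) (s≤s (bound₁ n))

  C₁-orderly : Orderly C₁
  C₁-orderly = orderly-by-invariant (∈-++⁺ˡ (1∈oneTo 0<m)) positive-C₁ Normal₁ (small z≤n) absorb₁ bound₁

-- The three exchanges between big coins, valid for any value d = 2m.
exchange-DD₁ : ∀ d σ → d + (suc d + σ) ≡ (d + d) + suc σ
exchange-DD₁ = solve-∀

exchange-D₁D : ∀ d σ → suc d + (d + σ) ≡ (d + d) + suc σ
exchange-D₁D = solve-∀

exchange-D₁D₁ : ∀ d σ → suc d + (suc d + σ) ≡ (d + d) + (2 + σ)
exchange-D₁D₁ = solve-∀

module _ {m : ℕ} (2≤m : 2 ≤ m) where
  open Family m

  private
    0<m : 0 < m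
    0<m = ≤-trans (s≤s z≤n) 2≤m

  D<Q : D < Q
  D<Q = m<m+n D (0<D 0<m)

  positive-C₃ : Positive C₃
  positive-C₃ = positive-snoc (positive-C₂ 0<m) (<-trans (0<D 0<m) D<Q)

  steps-C₃ : StepsAtLeast C₃ m
  steps-C₃ = steps-snoc {C₂} (steps-snoc {C₁} (steps-C₁ 0<m) (≤-trans m≤D (n≤1+n D))) (≤-trans m≤D (<⇒≤ D<Q))
    where m≤D = m≤m+n m m

  coin₃ : ∀ {a} → a ∈ C₃ → Coin₃ a
  coin₃ a∈ with ∈-snoc⁻ a∈
  ... | inj₂ refl = coinQ
  ... | inj₁ a∈C₂ with ∈-snoc⁻ a∈C₂
  ...   | inj₂ refl = coinD₁
  ...   | inj₁ a∈C₁ with ∈-snoc⁻ a∈C₁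
  ...     | inj₂ refl     = coinD
  ...     | inj₁ a∈oneTo = smallCoin (proj₂ (∈-oneTo⁻ a∈oneTo))

  -- Adding a coin to a normal form for C₃ gives a normal form with one more coin: small
  -- coins and 4m's are moved into place, two big coins are exchanged via 4m (2 ≤ m).
  absorb₃ : ∀ {a x k} → Coin₃ a → Normal₃ x k → Normal₃ (a + x) (suc k)
  absorb₃ coinQ n = plusQ n
  absorb₃ {a} c (plusQ {x} n) = recast₃ (sym (+-exchange a Q x)) (plusQ (absorb₃ c n))
  absorb₃ (smallCoin a≤m) (small σ≤) = small (+-mono-≤ a≤m σ≤)
  absorb₃ {a} (smallCoin a≤m) (withD {σ} σ≤) =
    recast₃ (sym (+-exchange a D σ)) (withD (+-mono-≤ a≤m σ≤))
  absorb₃ {a} (smallCoin a≤m) (withD₁ {σ} σ≤) =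
    recast₃ (sym (+-exchange a D₁ σ)) (withD₁ (+-mono-≤ a≤m σ≤))
  absorb₃ coinD (small σ≤) = withD σ≤
  absorb₃ coinD (withD {σ} {s} σ≤) =
    recast₃ (+-assoc D D σ) (plusQ (small (≤-trans σ≤ (m≤n+m (s * m) m))))
  absorb₃ coinD (withD₁ {σ} σ≤) =
    recast₃ (sym (exchange-DD₁ D σ)) (plusQ (small (+-mono-≤ 0<m σ≤)))
  absorb₃ coinD₁ (small σ≤) = withD₁ σ≤
  absorb₃ coinD₁ (withD {σ} σ≤) =
    recast₃ (sym (exchange-D₁D D σ)) (plusQ (small (+-mono-≤ 0<m σ≤)))
  absorb₃ coinD₁ (withD₁ {σ} σ≤) =
    recast₃ (sym (exchange-D₁D₁ D σ)) (plusQ (small (+-mono-≤ 2≤m σ≤)))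

  D₁-bound : ∀ {σ s} → σ ≤ s * m → grd C₃ (D₁ + σ) ≤ suc s
  D₁-bound {σ} {s} σ≤ with Q ≤? D₁ + σ
  ... | yes Q≤ = begin
    grd C₃ (D₁ + σ)             ≡⟨ grd-step positive-C₃ (largestCoin-snoc-fits C₂ Q≤) ⟩
    suc (grd C₃ (D₁ + σ ∸ Q))   ≤⟨ s≤s (greedy-within positive-C₃ steps-C₃ s _ (≤-trans rest≤σ σ≤)) ⟩
    suc s                       ∎
    where
    open ≤-Reasoning
    rest≤σ : D₁ + σ ∸ Q ≤ σ
    rest≤σ = ≤-trans (∸-monoʳ-≤ (D₁ + σ) D<Q) (≤-reflexive (m+n∸m≡n D₁ σ))
  ... | no Q≰ = begin
    grd C₃ (D₁ + σ)   ≡⟨ grd-step+ positive-C₃ (trans (largestCoin-snoc-skip C₂ (≰⇒> Q≰))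
                                                       (largestCoin-snoc-fits C₁ (m≤m+n D₁ σ))) ⟩
    suc (grd C₃ σ)    ≤⟨ s≤s (greedy-within positive-C₃ steps-C₃ s σ σ≤) ⟩
    suc s             ∎
    where open ≤-Reasoning

  -- Greedy pays a normal form with at most as many coins; for 2m + σ with σ > 0 it
  -- sees (2m+1) + (σ - 1).
  bound₃ : ∀ {x k} → Normal₃ x k → grd C₃ x ≤ k
  bound₃ (small σ≤)  = greedy-within positive-C₃ steps-C₃ _ _ σ≤
  bound₃ (withD₁ σ≤) = D₁-bound σ≤
  bound₃ (plusQ n)   = ≤-trans (≤-reflexive (grd-top positive-C₃)) (s≤s (bound₃ n))
  bound₃ (withD {zero} _) rewrite +-identityʳ D = begin
    grd C₃ D                ≡⟨ grd-step positive-C₃ lc-D ⟩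
    suc (grd C₃ (D ∸ D))    ≡⟨ cong (suc ∘ grd C₃) (n∸n≡0 D) ⟩
    1                       ≤⟨ s≤s z≤n ⟩
    suc _                   ∎
    where
    open ≤-Reasoning
    lc-D : largestCoin C₃ D ≡ just D
    lc-D = trans (largestCoin-snoc-skip C₂ D<Q)
             (trans (largestCoin-snoc-skip C₁ (n<1+n D)) (largestCoin-snoc-fits (oneTo m) ≤-refl))
  bound₃ (withD {suc σ} σ≤) rewrite +-suc D σ = D₁-bound (≤-trans (n≤1+n σ) σ≤)

  C₃-orderly : Orderly C₃
  C₃-orderly = orderly-by-invariant (∈-++⁺ˡ (∈-++⁺ˡ (∈-++⁺ˡ (1∈oneTo 0<m)))) positive-C₃ Normal₃
    (small z≤n) (absorb₃ ∘ coin₃) bound₃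

C₂-not-orderly : ∀ {m} → 2 ≤ m → ¬ Orderly (Family.C₂ m)
C₂-not-orderly {suc m′} (s≤s 0<m′) orderly =
  contradiction (subst (_≤ 2) greedy-Q greedy≤2) λ { (s≤s (s≤s ())) }
  where
  m = suc m′
  open Family m
  pos = positive-C₂ (s≤s z≤n)

  twoD : Rep C₂ Q (D ∷ D ∷ [])
  twoD = D∈ ∷ D∈ ∷ [] , cong (D +_) (+-identityʳ D)
    where D∈ = ∈-++⁺ˡ (∈-++⁺ʳ (oneTo m) (here refl))

  greedy≤2 : grd C₂ Q ≤ 2
  greedy≤2 = proj₂ (orderly Q (s≤s z≤n)) (D ∷ D ∷ []) twoD

  -- 4m = (2m+1) + (m + (m-1)), written with m = m′ + 1.
  Q-split : Q ≡ D₁ + (m + m′)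
  Q-split = split m′
    where
    split : ∀ k → (suc k + suc k) + (suc k + suc k) ≡ suc (suc k + suc k) + (suc k + k)
    split = solve-∀

  below-D : ∀ {r} → r < D → largestCoin C₂ r ≡ largestCoin (oneTo m) r
  below-D r<D = trans (largestCoin-snoc-skip C₁ (m<n⇒m<1+n r<D)) (largestCoin-snoc-skip (oneTo m) r<D)

  greedy-Q : grd C₂ Q ≡ 3
  greedy-Q = begin
    grd C₂ Q                 ≡⟨ cong (grd C₂) Q-split ⟩
    grd C₂ (D₁ + (m + m′))   ≡⟨ grd-step+ pos (largestCoin-snoc-fits C₁ (m≤m+n D₁ (m + m′))) ⟩
    suc (grd C₂ (m + m′))    ≡⟨ cong suc (grd-step+ pos (trans (below-D (+-monoʳ-< m (n<1+n m′)))
                                                              (largestCoin-oneTo-top (s≤s z≤n) (m≤m+n m m′)))) ⟩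
    suc (suc (grd C₂ m′))    ≡⟨ cong (suc ∘ suc) (grd-step pos (trans (below-D (<-≤-trans (n<1+n m′) (m≤m+n m m)))
                                                                        (largestCoin-oneTo-exact 0<m′ (n≤1+n m′)))) ⟩
    3 + grd C₂ (m′ ∸ m′)     ≡⟨ cong (λ r → 3 + grd C₂ r) (n∸n≡0 m′) ⟩
    3                        ∎
    where open ≡-Reasoning

take-applyUpTo : ∀ {A : Set} (f : ℕ → A) {n m} → n ≤ m → take n (applyUpTo f m) ≡ applyUpTo f n
take-applyUpTo f z≤n        = refl
take-applyUpTo f (s≤s n≤m) = cong (f 0 ∷_) (take-applyUpTo (f ∘ suc) n≤m)

take-++-length : ∀ {A : Set} (xs ys : List A) k → take (length xs + k) (xs ++ ys) ≡ xs ++ take k ys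
take-++-length []       ys k = refl
take-++-length (x ∷ xs) ys k = cong (x ∷_) (take-++-length xs ys k)

take-++-short : ∀ {A : Set} (xs ys : List A) {n} → n ≤ length xs → take n (xs ++ ys) ≡ take n xs
take-++-short xs       ys {zero}  _         = refl
take-++-short (x ∷ xs) ys {suc n} (s≤s n≤) = cong (x ∷_) (take-++-short xs ys n≤)

length-oneTo : ∀ n → length (oneTo n) ≡ n
length-oneTo n = trans (length-map suc (upTo n)) (length-upTo n)

B-shape : ∀ m → B (suc m) ≡ oneTo m ++ Family.tail m
B-shape m = cong₂ (λ x y → oneTo m ++ (x ∸ 2) ∷ (x ∸ 1) ∷ (y ∸ 4) ∷ []) (twice m) (four-times m)
  where
  twice : ∀ m → 2 * suc m ≡ 2 + (m + m)
  twice = solve-∀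
  four-times : ∀ m → 4 * suc m ≡ 4 + ((m + m) + (m + m))
  four-times = solve-∀

B-prefix-short : ∀ m {n} → n ≤ m → take n (B (suc m)) ≡ oneTo n
B-prefix-short m {n} n≤m = begin
  take n (B (suc m))                   ≡⟨ cong (take n) (B-shape m) ⟩
  take n (oneTo m ++ Family.tail m)    ≡⟨ take-++-short (oneTo m) _ (subst (n ≤_) (sym (length-oneTo m)) n≤m) ⟩
  take n (oneTo m)                     ≡⟨ take-map n (upTo m) ⟩
  map suc (take n (upTo m))            ≡⟨ cong (map suc) (take-applyUpTo (λ i → i) n≤m) ⟩
  oneTo n                              ∎
  where open ≡-Reasoning

B-prefix-long : ∀ m k → take (m + k) (B (suc m)) ≡ oneTo m ++ take k (Family.tail m)
B-prefix-long m k = begin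
  take (m + k) (B (suc m))                         ≡⟨ cong (take (m + k)) (B-shape m) ⟩
  take (m + k) (oneTo m ++ Family.tail m)          ≡⟨ cong (λ n → take (n + k) (oneTo m ++ Family.tail m)) (sym (length-oneTo m)) ⟩
  take (length (oneTo m) + k) (oneTo m ++ Family.tail m) ≡⟨ take-++-length (oneTo m) _ k ⟩
  oneTo m ++ take k (Family.tail m)                ∎
  where open ≡-Reasoning

module _ (m : ℕ) where
  open Family m

  B-prefix-C₂ : take (suc m + 1) (B (suc m)) ≡ C₂
  B-prefix-C₂ = trans (cong (λ n → take n (B (suc m))) (sym (+-suc m 1)))
                  (trans (B-prefix-long m 2) (sym (++-assoc (oneTo m) (D ∷ []) (D₁ ∷ []))))

  B-prefix-C₃ : take (m + 3) (B (suc m)) ≡ C₃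
  B-prefix-C₃ = trans (B-prefix-long m 3)
                  (sym (trans (++-assoc C₁ (D₁ ∷ []) (Q ∷ [])) (++-assoc (oneTo m) (D ∷ []) (D₁ ∷ Q ∷ []))))

prefix-orderly : ∀ m → 2 ≤ m → ∀ j → j ≤ suc m + 1 → j ≢ suc m → Orderly (take (j + 1) (B (suc m)))
prefix-orderly m 2≤m j j≤ j≢ with compare j m
... | less _ k = subst Orderly (sym (B-prefix-short (suc (j + k)) j+1≤)) (oneTo-orderly (m≤n+m 1 j))
  where
  j+1≤ : j + 1 ≤ suc (j + k)
  j+1≤ = subst (j + 1 ≤_) (+-suc j k) (+-monoʳ-≤ j (s≤s z≤n))
... | equal _ = subst Orderly (sym (B-prefix-long m 1)) (C₁-orderly (≤-trans (s≤s z≤n) 2≤m))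
... | greater _ zero = contradiction (cong suc (+-identityʳ m)) j≢
... | greater _ (suc zero) =
  subst Orderly (sym (trans (cong (λ n → take n (B (suc m))) index) (B-prefix-C₃ m))) (C₃-orderly 2≤m)
  where
  index : suc (m + 1) + 1 ≡ m + 3
  index = trans (cong suc (+-assoc m 1 1)) (sym (+-suc m 2))
... | greater _ (suc (suc k)) with s≤s () ← +-cancelˡ-≤ m (suc (suc k)) 1 (s≤s⁻¹ j≤)

lemma7p2 : ∀ (l : ℕ) → 3 ≤ l →
    (∀ (j : ℕ) → j ≤ l + 1 → j ≢ l → Orderly (take (j + 1) (B l)))
    × ¬ Orderly (take (l + 1) (B l))
lemma7p2 (suc m) (s≤s 2≤m) =
  prefix-orderly m 2≤m , λ orderly → C₂-not-orderly 2≤m (subst Orderly (B-prefix-C₂ m) orderly)
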